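{- Let $k\ge 3$ and let $G$ be a $k$-connected equimatchable factor-critical graph with a vertex cut $S$ of size $k$. Then $G-S$ has at most $k$ components. Moreover, this bound is tight: for every $k\ge 3$ there exists a $k$-connected equimatchable factor-critical graph $G$ with a vertex cut $S$ of size $k$ such that $G-S$ has exactly $k$ components.
   Context: All graphs are finite, simple and undirected. A graph is equimatchable if every maximal matching is a maximum matching. A graph is factor-critical if $G-v$ has a perfect matching for every vertex $v$. -}

module Defs where

open import Data.Nat using (ℕ; _<_)
open import Data.Bool using (Bool; true; false)
open import Data.Fin using (Fin)
open import Data.Fin.Subset using (Subset; _∈_; _∉_; ∣_∣)
open import Data.List using (List; []; _∷_; length; concatMap)
open import Data.List.Relation.Unary.All using (All)
open import Data.List.Relation.Unary.Unique.Propositional using (Unique)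
import Data.List.Membership.Propositional as LM
open import Data.Product using (Σ; _×_; _,_; ∃)
open import Relation.Binary.PropositionalEquality using (_≡_)
open import Relation.Nullary using (¬_)
open import Data.Empty using (⊥)

record Graph (n : ℕ) : Set where
  field
    E     : Fin n → Fin n → Bool
    sym   : ∀ u v → E u v ≡ E v u
    irref : ∀ v → E v v ≡ false

module _ {n : ℕ} (G : Graph n) where
  open Graph G

  Adj : Fin n → Fin n → Set
  Adj u v = E u v ≡ true

  Edge : Set
  Edge = Fin n × Fin n

  endpoints : List Edge → List (Fin n)
  endpoints = concatMap (λ { (u , v) → u ∷ v ∷ [] })

  record Matching : Set where
    field
      edges    : List Edge
      areEdges : All (λ { (u , v) → Adj u v }) edges
      disjoint : Unique (endpoints edges)

  open Matching public

  size : Matching → ℕ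
  size M = length (edges M)

  Covered : Matching → Fin n → Set
  Covered M v = v LM.∈ endpoints (edges M)

  IsMaximal : Matching → Set
  IsMaximal M = ∀ u v → Adj u v → ¬ Covered M u → ¬ Covered M v → ⊥

  IsMaximum : Matching → Set
  IsMaximum M = ∀ (M' : Matching) → ¬ (size M < size M')

  Equimatchable : Set
  Equimatchable = ∀ (M : Matching) → IsMaximal M → IsMaximum M

  -- G - v has a perfect matching: a matching of G not covering v
  -- (hence using only edges of G - v) covering every other vertex.
  FactorCritical : Set
  FactorCritical = ∀ (v : Fin n) → Σ Matching λ M →
    (¬ Covered M v) × (∀ w → ¬ w ≡ v → Covered M w)

  data Reach (X : Subset n) : Fin n → Fin n → Set where
    here : ∀ {v} → v ∉ X → Reach X v v
    step : ∀ {u v w} → u ∉ X → Adj u v → Reach X v w → Reach X u w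

  ConnectedMinus : Subset n → Set
  ConnectedMinus X = ∀ u v → u ∉ X → v ∉ X → Reach X u v

  KConnected : ℕ → Set
  KConnected k = k < n × (∀ (X : Subset n) → ∣ X ∣ < k → ConnectedMinus X)

  IsVertexCut : Subset n → Set
  IsVertexCut S = ∃ λ u → ∃ λ v → u ∉ S × v ∉ S × ¬ Reach S u v

  -- G - S has exactly m components: there is a system of representatives
  -- r : Fin m → V(G - S), one per component (pairwise in different
  -- components, and every vertex of G - S is in the component of some r i).
  HasComponents : Subset n → ℕ → Set
  HasComponents S m = Σ (Fin m → Fin n) λ r →
    (∀ i → r i ∉ S) ×
    (∀ i j → Reach S (r i) (r j) → i ≡ j) ×
    (∀ v → v ∉ S → ∃ λ i → Reach S v (r i))

-- Suppose m > k. Take x ∈ S, a perfect matching of G - x, another s ∈ S and its partner q, and delete sq.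
-- The remaining matching M has size one less than maximum, its exposed vertices in S are x, s and (if q ∈ S) q,
-- and the components of G - S joined to S by M are at most k minus that many. As S is a minimum cut, every
-- vertex of S has a neighbour in every component, so each exposed vertex a ∈ S can be rerouted into a fresh
-- component c untouched by M: match a to a neighbour y ∈ c and unmatch y's partner, which lies in c. Counting
-- shows there are enough fresh components, and afterwards the exposed vertices lie outside S in distinct
-- components, so the matching is maximal but not maximum, contradicting equimatchability.
-- Tightness: K_{k,k+1} plus one edge inside the larger part, cut at the smaller part.
module Submission where

open import Defs
open import Data.Nat using (ℕ; zero; suc; _+_; _≤_; _<_; _≤?_; s≤s; z≤n)
open import Data.Nat.Properties
  using (+-suc; +-comm; ≤-trans; ≤-reflexive; <⇒≤; <⇒≱; <⇒≢; ≰⇒>; <-irrefl; <-≤-trans; ≤-<-trans; +-monoʳ-≤; +-mono-≤;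
         n≤1+n; m≤m+n; m≤n+m)
open import Data.Bool using (Bool; true; false)
open import Data.Empty using (⊥; ⊥-elim)
open import Data.Fin using (Fin; zero; suc; fromℕ<; _↑ˡ_; _↑ʳ_; splitAt; punchIn; punchOut; pinch)
import Data.Fin.Properties as Finₚ
open import Data.Fin.Subset using (Subset; ∣_∣; _-_; ⁅_⁆; Nonempty; inside)
  renaming (_∈_ to _∈ₛ_; _∉_ to _∉ₛ_; ⊥ to ∅)
open import Data.Fin.Subset.Properties
  using (_∈?_; nonempty?; Empty-unique; ∣⊥∣≡0; ∣⁅x⁆∣≡1; ∉⊥; p⊆q⇒∣p∣≤∣q∣; p─q⊆p; x∈⁅x⁆; x∈p⇒∣p-x∣<∣p∣;
         x∈p∧x∉q⇒x∈p─q; x≢y⇒x∉⁅y⁆)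
import Data.Vec.Base as Vec
open import Data.List using (List; []; _∷_; _++_; length; lookup; map; filter; allFin)
open import Data.List.Properties using (length-map; length-tabulate; length-++; filter-accept)
open import Data.List.Relation.Unary.All as All using (All; []; _∷_)
open import Data.List.Relation.Unary.All.Properties as Allₚ using (¬Any⇒All¬; All¬⇒¬Any)
open import Data.List.Relation.Unary.AllPairs using ([]; _∷_)
open import Data.List.Relation.Unary.Any using (here; there; index; any?)
open import Data.List.Relation.Unary.Unique.Propositional using (Unique)
import Data.List.Relation.Unary.Unique.Propositional.Properties as Uniqueₚ
open import Data.List.Membership.Propositional using (_∈_; _∉_)
open import Data.List.Membership.Propositional.Properties using (∈-lookup; ∈-allFin; ∈-map⁺; ∈-map⁻; ∈-∃++; ∈-filter⁻)
import Data.List.Membership.Setoid.Properties as Membershipₛ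
open import Data.List.Relation.Binary.Permutation.Propositional as ↭ using (_↭_; prep; swap; ↭-sym; ↭⇒↭ₛ)
open import Data.List.Relation.Binary.Permutation.Propositional.Properties
  using (↭-length; ∈-resp-↭; All-resp-↭; shift; shifts)
import Data.List.Relation.Binary.Permutation.Setoid.Properties as Permutationₛ
open import Data.Product using (Σ; ∃; _×_; _,_; proj₁; proj₂)
open import Data.Sum using (_⊎_; inj₁; inj₂)
open import Function using (_∘_)
open import Relation.Binary.PropositionalEquality as ≡ using (_≡_; _≢_; refl; sym; trans; cong; subst; subst₂)
open import Relation.Nullary using (¬_; Dec; yes; no; ¬?; contradiction)
open import Relation.Nullary.Decidable using (_×-dec_)

length-allFin : ∀ n → length (allFin n) ≡ n
length-allFin n = length-tabulate (λ i → i)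

length-map-allFin : ∀ {A : Set} n (f : Fin n → A) → length (map f (allFin n)) ≡ n
length-map-allFin n f = trans (length-map f (allFin n)) (length-allFin n)

_∈ₗ?_ : ∀ {n} (x : Fin n) (xs : List (Fin n)) → Dec (x ∈ xs)
x ∈ₗ? xs = any? (x Finₚ.≟_) xs

module _ {A : Set} where

  Unique-resp-↭ : ∀ {xs ys : List A} → Unique xs → xs ↭ ys → Unique ys
  Unique-resp-↭ u p = Permutationₛ.Unique-resp-↭ (≡.setoid A) (↭⇒↭ₛ p) u

  lookup-injective : ∀ {xs : List A} → Unique xs → ∀ {i j} → lookup xs i ≡ lookup xs j → i ≡ j
  lookup-injective (x∉xs ∷ _) {zero}  {zero}  _  = refl
  lookup-injective (x∉xs ∷ _) {zero}  {suc j} eq = contradiction eq (All.lookup x∉xs (∈-lookup j))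
  lookup-injective (x∉xs ∷ _) {suc i} {zero}  eq = contradiction (sym eq) (All.lookup x∉xs (∈-lookup i))
  lookup-injective (_ ∷ u)    {suc i} {suc j} eq = cong suc (lookup-injective u eq)

  Unique⇒length-mono-⊆ : ∀ {xs ys : List A} → Unique xs → (∀ {x} → x ∈ xs → x ∈ ys) → length xs ≤ length ys
  Unique⇒length-mono-⊆ {xs} {ys} u xs⊆ys with length xs ≤? length ys
  ... | yes xs≤ys = xs≤ys
  ... | no xs≰ys with i , j , i<j , eq ← Finₚ.pigeonhole (≰⇒> xs≰ys) (λ i → index (xs⊆ys (∈-lookup i)))
    = contradiction
        (lookup-injective u (Membershipₛ.index-injective (≡.setoid A) (xs⊆ys (∈-lookup i)) (xs⊆ys (∈-lookup j)) eq))
        (Finₚ.<⇒≢ i<j)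

Unique⇒length≤∣p∣ : ∀ {n} (p : Subset n) {xs : List (Fin n)} → Unique xs → All (_∈ₛ p) xs → length xs ≤ ∣ p ∣
Unique⇒length≤∣p∣ p {[]} _ _ = z≤n
Unique⇒length≤∣p∣ p {x ∷ xs} (x∉xs ∷ u) (x∈p ∷ xs⊆p) =
  ≤-trans (s≤s (Unique⇒length≤∣p∣ (p - x) u (All.zipWith inP-x (x∉xs , xs⊆p)))) (x∈p⇒∣p-x∣<∣p∣ x∈p)
  where
  inP-x : ∀ {y} → x ≢ y × y ∈ₛ p → y ∈ₛ p - x
  inP-x (x≢y , y∈p) = x∈p∧x∉q⇒x∈p─q y∈p (x≢y⇒x∉⁅y⁆ (λ y≡x → x≢y (sym y≡x)))

∃∉ : ∀ {m} (L : List (Fin m)) → length L < m → ∃ λ c → c ∉ L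
∃∉ {m} L L<m with Finₚ.any? (λ (c : Fin m) → ¬? (c ∈ₗ? L))
... | yes c∉L = c∉L
... | no ¬c∉L =
  contradiction (Unique⇒length-mono-⊆ (Uniqueₚ.allFin⁺ m) allFin⊆L)
                (<⇒≱ (subst (length L <_) (sym (length-allFin m)) L<m))
  where
  allFin⊆L : ∀ {c} → c ∈ allFin m → c ∈ L
  allFin⊆L {c} _ with c ∈ₗ? L
  ... | yes c∈L = c∈L
  ... | no c∉L = contradiction (c , c∉L) ¬c∉L

∃∉ₛ : ∀ {n r} (f : Fin r → Fin n) → (∀ {i j} → f i ≡ f j → i ≡ j) → (p : Subset n) → ∣ p ∣ < r → ∃ λ i → f i ∉ₛ p
∃∉ₛ {r = r} f f-inj p p<r with Finₚ.any? (λ (i : Fin r) → ¬? (f i ∈? p))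
... | yes fi∉p = fi∉p
... | no ¬fi∉p =
  contradiction (Unique⇒length≤∣p∣ p (Uniqueₚ.map⁺ f-inj (Uniqueₚ.allFin⁺ r)) (All.tabulate image⊆p))
                (<⇒≱ (subst (∣ p ∣ <_) (sym (length-map-allFin r f)) p<r))
  where
  image⊆p : ∀ {v} → v ∈ map f (allFin r) → v ∈ₛ p
  image⊆p v∈ with ∈-map⁻ f v∈
  ... | i , _ , refl with f i ∈? p
  ...   | yes fi∈p = fi∈p
  ...   | no fi∉p = contradiction (i , fi∉p) ¬fi∉p

∃≢ : ∀ {m} → 1 < m → (c : Fin m) → ∃ λ c′ → c ≢ c′
∃≢ (s≤s (s≤s _)) zero = suc zero , λ ()
∃≢ (s≤s (s≤s _)) (suc c) = zero , λ ()

nonempty : ∀ {n} {p : Subset n} → 0 < ∣ p ∣ → Nonempty p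
nonempty {n} {p} 0<p with nonempty? p
... | yes ne = ne
... | no empty = contradiction (trans (cong ∣_∣ (Empty-unique empty)) (∣⊥∣≡0 n)) (λ p≡0 → <⇒≢ 0<p (sym p≡0))

∃∈-≢ : ∀ {n} {p : Subset n} → 1 < ∣ p ∣ → ∀ x → ∃ λ y → y ∈ₛ p × y ≢ x
∃∈-≢ {n} {p} 1<p x with Finₚ.any? (λ (y : Fin n) → (y ∈? p) ×-dec ¬? (y Finₚ.≟ x))
... | yes found = found
... | no none = contradiction (≤-trans (p⊆q⇒∣p∣≤∣q∣ p⊆⁅x⁆) (≤-reflexive (∣⁅x⁆∣≡1 x))) (<⇒≱ 1<p)
  where
  p⊆⁅x⁆ : ∀ {y} → y ∈ₛ p → y ∈ₛ ⁅ x ⁆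
  p⊆⁅x⁆ {y} y∈p with y Finₚ.≟ x
  ... | yes refl = x∈⁅x⁆ x
  ... | no y≢x = contradiction (y , y∈p , y≢x) none

module _ {n : ℕ} (G : Graph n) where

  Adj-sym : ∀ {u v} → Adj G u v → Adj G v u
  Adj-sym {u} {v} = trans (Graph.sym G v u)

  Adj-irrefl : ∀ {u v} → Adj G u v → u ≢ v
  Adj-irrefl {u} uu refl with trans (sym uu) (Graph.irref G u)
  ... | ()

  module _ {X : Subset n} where

    Reach-source : ∀ {u v} → Reach G X u v → u ∉ₛ X
    Reach-source (here u∉X) = u∉X
    Reach-source (step u∉X _ _) = u∉X

    Reach-target : ∀ {u v} → Reach G X u v → v ∉ₛ X
    Reach-target (here v∉X) = v∉X
    Reach-target (step _ _ r) = Reach-target r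

    Reach-trans : ∀ {u v w} → Reach G X u v → Reach G X v w → Reach G X u w
    Reach-trans (here _) r = r
    Reach-trans (step u∉X uv r) r′ = step u∉X uv (Reach-trans r r′)

    Reach-sym : ∀ {u v} → Reach G X u v → Reach G X v u
    Reach-sym (here v∉X) = here v∉X
    Reach-sym (step u∉X uv r) = Reach-trans (Reach-sym r) (step (Reach-source r) (Adj-sym uv) (here u∉X))

  Exposed : Matching G → Fin n → Set
  Exposed M v = ¬ Covered G M v

  data Matched (M : Matching G) (u v : Fin n) : Set where
    as-listed : (u , v) ∈ edges M → Matched M u v
    reversed  : (v , u) ∈ edges M → Matched M u v

  Matched-sym : ∀ {M u v} → Matched M u v → Matched M v u
  Matched-sym (as-listed uv) = reversed uv
  Matched-sym (reversed vu) = as-listed vu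

  endpoints-↭ : ∀ {es es′ : List (Edge G)} → es ↭ es′ → endpoints G es ↭ endpoints G es′
  endpoints-↭ ↭.refl = ↭.refl
  endpoints-↭ (prep (u , v) p) = prep u (prep v (endpoints-↭ p))
  endpoints-↭ (swap (u , v) (u′ , v′) p) =
    ↭.trans (shifts (u ∷ v ∷ []) (u′ ∷ v′ ∷ [])) (prep u′ (prep v′ (prep u (prep v (endpoints-↭ p)))))
  endpoints-↭ (↭.trans p q) = ↭.trans (endpoints-↭ p) (endpoints-↭ q)

  ∈-endpoints⁻ : ∀ {w} (es : List (Edge G)) → w ∈ endpoints G es → ∃ λ p → (w , p) ∈ es ⊎ (p , w) ∈ es
  ∈-endpoints⁻ ((u , v) ∷ es) (here refl) = v , inj₁ (here refl)
  ∈-endpoints⁻ ((u , v) ∷ es) (there (here refl)) = u , inj₂ (here refl)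
  ∈-endpoints⁻ (_ ∷ es) (there (there w∈)) with ∈-endpoints⁻ es w∈
  ... | p , inj₁ wp = p , inj₁ (there wp)
  ... | p , inj₂ pw = p , inj₂ (there pw)

  data Extends (M′ : Matching G) (a b : Fin n) (M : Matching G) : Set where
    forward  : edges M ↭ (a , b) ∷ edges M′ → Extends M′ a b M
    backward : edges M ↭ (b , a) ∷ edges M′ → Extends M′ a b M

  module _ {M′ M : Matching G} {a b : Fin n} where

    extends-size : Extends M′ a b M → size G M ≡ suc (size G M′)
    extends-size (forward p) = ↭-length p
    extends-size (backward p) = ↭-length p

    extends-endpoints : Extends M′ a b M → endpoints G (edges M) ↭ a ∷ b ∷ endpoints G (edges M′)
    extends-endpoints (forward p) = endpoints-↭ p
    extends-endpoints (backward p) = ↭.trans (endpoints-↭ p) (swap b a ↭.refl)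

    extends-covered⁺ : Extends M′ a b M → ∀ {u} → Covered G M′ u → Covered G M u
    extends-covered⁺ ext c = ∈-resp-↭ (↭-sym (extends-endpoints ext)) (there (there c))

    extends-covers-ends : Extends M′ a b M → Covered G M a × Covered G M b
    extends-covers-ends ext = ∈-resp-↭ (↭-sym (extends-endpoints ext)) (here refl)
                            , ∈-resp-↭ (↭-sym (extends-endpoints ext)) (there (here refl))

    extends-covered⁻ : Extends M′ a b M → ∀ {u} → Covered G M u → u ≡ a ⊎ u ≡ b ⊎ Covered G M′ u
    extends-covered⁻ ext c with ∈-resp-↭ (extends-endpoints ext) c
    ... | here u≡a = inj₁ u≡a
    ... | there (here u≡b) = inj₂ (inj₁ u≡b)
    ... | there (there c′) = inj₂ (inj₂ c′)

    extends-exposes-ends : Extends M′ a b M → Exposed M′ a × Exposed M′ b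
    extends-exposes-ends ext with Unique-resp-↭ (disjoint M) (extends-endpoints ext)
    ... | (_ ∷ a∉) ∷ b∉ ∷ _ = All¬⇒¬Any a∉ , All¬⇒¬Any b∉

    extends-edge⁺ : Extends M′ a b M → ∀ {e} → e ∈ edges M′ → e ∈ edges M
    extends-edge⁺ (forward p) e∈ = ∈-resp-↭ (↭-sym p) (there e∈)
    extends-edge⁺ (backward p) e∈ = ∈-resp-↭ (↭-sym p) (there e∈)

    extends-edge⁻ : Extends M′ a b M → ∀ {e} → e ∈ edges M → e ≡ (a , b) ⊎ e ≡ (b , a) ⊎ e ∈ edges M′
    extends-edge⁻ (forward p) e∈ with ∈-resp-↭ p e∈
    ... | here e≡ab = inj₁ e≡ab
    ... | there e∈′ = inj₂ (inj₂ e∈′)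
    extends-edge⁻ (backward p) e∈ with ∈-resp-↭ p e∈
    ... | here e≡ba = inj₂ (inj₁ e≡ba)
    ... | there e∈′ = inj₂ (inj₂ e∈′)

    extends-matches-ends : Extends M′ a b M → Matched M a b
    extends-matches-ends (forward p) = as-listed (∈-resp-↭ (↭-sym p) (here refl))
    extends-matches-ends (backward p) = reversed (∈-resp-↭ (↭-sym p) (here refl))

    extends-matched⁺ : Extends M′ a b M → ∀ {u v} → Matched M′ u v → Matched M u v
    extends-matched⁺ ext (as-listed uv) = as-listed (extends-edge⁺ ext uv)
    extends-matched⁺ ext (reversed vu) = reversed (extends-edge⁺ ext vu)

    extends-matched⁻ : Extends M′ a b M → ∀ {u v} → Matched M u v →
                       (u ≡ a × v ≡ b) ⊎ (u ≡ b × v ≡ a) ⊎ Matched M′ u v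
    extends-matched⁻ ext (as-listed uv) with extends-edge⁻ ext uv
    ... | inj₁ refl = inj₁ (refl , refl)
    ... | inj₂ (inj₁ refl) = inj₂ (inj₁ (refl , refl))
    ... | inj₂ (inj₂ uv′) = inj₂ (inj₂ (as-listed uv′))
    extends-matched⁻ ext (reversed vu) with extends-edge⁻ ext vu
    ... | inj₁ refl = inj₂ (inj₁ (refl , refl))
    ... | inj₂ (inj₁ refl) = inj₁ (refl , refl)
    ... | inj₂ (inj₂ vu′) = inj₂ (inj₂ (reversed vu′))

  extend : (M′ : Matching G) {a b : Fin n} → Adj G a b → Exposed M′ a → Exposed M′ b → ∃ λ M → Extends M′ a b M
  extend M′ {a} {b} ab a-exp b-exp =
    record { edges = (a , b) ∷ edges M′
           ; areEdges = ab ∷ areEdges M′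
           ; disjoint = (Adj-irrefl ab ∷ ¬Any⇒All¬ _ a-exp) ∷ ¬Any⇒All¬ _ b-exp ∷ disjoint M′ }
    , forward ↭.refl

  remove : (M : Matching G) {e : Edge G} → e ∈ edges M → ∃ λ (M′ : Matching G) → edges M ↭ e ∷ edges M′
  remove M {e} e∈ with xs , ys , eq ← ∈-∃++ e∈ =
    record { edges = xs ++ ys
           ; areEdges = All.tail (All-resp-↭ pull (areEdges M))
           ; disjoint = drop₂ (Unique-resp-↭ (disjoint M) (endpoints-↭ pull)) }
    , pull
    where
    pull : edges M ↭ e ∷ xs ++ ys
    pull = subst (_↭ e ∷ xs ++ ys) (sym eq) (shift e xs ys)
    drop₂ : ∀ {u v ws} → Unique (u ∷ v ∷ ws) → Unique ws
    drop₂ (_ ∷ _ ∷ u) = u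

  unmatch : (M : Matching G) {w : Fin n} → Covered G M w →
            ∃ λ p → Adj G w p × ∃ λ (M′ : Matching G) → Extends M′ w p M
  unmatch M {w} w∈ with ∈-endpoints⁻ (edges M) w∈
  ... | p , inj₁ wp = let M′ , pull = remove M wp in p , All.lookup (areEdges M) wp , M′ , forward pull
  ... | p , inj₂ pw = let M′ , pull = remove M pw in p , Adj-sym (All.lookup (areEdges M) pw) , M′ , backward pull

  module _ {I : Set} (f g : I → Fin n)
           (f-injective : ∀ {i j} → f i ≡ f j → i ≡ j) (g-injective : ∀ {i j} → g i ≡ g j → i ≡ j)
           (f≢g : ∀ i j → f i ≢ g j) (f-g-adjacent : ∀ i → Adj G (f i) (g i)) where

    pairing : (xs : List I) → Unique xs → Σ (Matching G) λ M →
              (∀ {w} → Covered G M w → ∃ λ j → j ∈ xs × (w ≡ f j ⊎ w ≡ g j)) ×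
              (∀ {j} → j ∈ xs → Covered G M (f j) × Covered G M (g j))
    pairing [] _ = record { edges = [] ; areEdges = [] ; disjoint = [] } , (λ ()) , (λ ())
    pairing (j ∷ xs) (j∉xs ∷ u) with M , covered⁻ , covered⁺ ← pairing xs u =
      M′ , covered′⁻ , covered′⁺
      where
      fj-exposed : Exposed M (f j)
      fj-exposed c with covered⁻ c
      ... | i , i∈xs , inj₁ fj≡fi = All.lookup j∉xs i∈xs (f-injective fj≡fi)
      ... | i , _ , inj₂ fj≡gi = f≢g j i fj≡gi
      gj-exposed : Exposed M (g j)
      gj-exposed c with covered⁻ c
      ... | i , _ , inj₁ gj≡fi = f≢g i j (sym gj≡fi)
      ... | i , i∈xs , inj₂ gj≡gi = All.lookup j∉xs i∈xs (g-injective gj≡gi)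
      M′ : Matching G
      M′ = proj₁ (extend M (f-g-adjacent j) fj-exposed gj-exposed)
      ext : Extends M (f j) (g j) M′
      ext = proj₂ (extend M (f-g-adjacent j) fj-exposed gj-exposed)
      covered′⁻ : ∀ {w} → Covered G M′ w → ∃ λ i → i ∈ j ∷ xs × (w ≡ f i ⊎ w ≡ g i)
      covered′⁻ c with extends-covered⁻ ext c
      ... | inj₁ w≡fj = j , here refl , inj₁ w≡fj
      ... | inj₂ (inj₁ w≡gj) = j , here refl , inj₂ w≡gj
      ... | inj₂ (inj₂ c′) with i , i∈xs , w≡ ← covered⁻ c′ = i , there i∈xs , w≡
      covered′⁺ : ∀ {i} → i ∈ j ∷ xs → Covered G M′ (f i) × Covered G M′ (g i)
      covered′⁺ (here refl) = extends-covers-ends ext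
      covered′⁺ (there i∈xs) with fi , gi ← covered⁺ i∈xs = extends-covered⁺ ext fi , extends-covered⁺ ext gi

  length-endpoints : ∀ es → length (endpoints G es) ≡ length es + length es
  length-endpoints [] = refl
  length-endpoints (e ∷ es) = cong suc (trans (cong suc (length-endpoints es)) (sym (+-suc (length es) (length es))))

  size+size≤n : ∀ M → size G M + size G M ≤ n
  size+size≤n M = subst₂ _≤_ (length-endpoints (edges M)) (length-allFin n)
                    (Unique⇒length-mono-⊆ (disjoint M) (λ {v} _ → ∈-allFin v))

  Independent : List (Fin n) → Set
  Independent A = ∀ {u v} → Adj G u v → u ∈ A → v ∉ A

  independent-covered≤size : ∀ M {A} → Unique A → Independent A → All (Covered G M) A → length A ≤ size G M
  independent-covered≤size M {A} uniqueA independent covered =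
    ≤-trans (Unique⇒length-mono-⊆ uniqueA A⊆ends) (≤-reflexive (length-map endInA (edges M)))
    where
    endInA : Edge G → Fin n
    endInA (u , v) with u ∈ₗ? A
    ... | yes _ = u
    ... | no _ = v
    endInA-fst : ∀ {u v} → u ∈ A → endInA (u , v) ≡ u
    endInA-fst {u} u∈A with u ∈ₗ? A
    ... | yes _ = refl
    ... | no u∉A = contradiction u∈A u∉A
    endInA-snd : ∀ {u v} → u ∉ A → endInA (u , v) ≡ v
    endInA-snd {u} u∉A with u ∈ₗ? A
    ... | yes u∈A = contradiction u∈A u∉A
    ... | no _ = refl
    A⊆ends : ∀ {a} → a ∈ A → a ∈ map endInA (edges M)
    A⊆ends {a} a∈A with ∈-endpoints⁻ (edges M) (All.lookup covered a∈A)
    ... | p , inj₁ ap = subst (_∈ map endInA (edges M)) (endInA-fst a∈A) (∈-map⁺ endInA ap)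
    ... | p , inj₂ pa = subst (_∈ map endInA (edges M)) (endInA-snd p∉A) (∈-map⁺ endInA pa)
      where
      p∉A : p ∉ A
      p∉A p∈A = independent (All.lookup (areEdges M) pa) p∈A a∈A

module Components {n : ℕ} (G : Graph n) (S : Subset n) {m : ℕ} (components : HasComponents G S m) (c₀ : Fin m) where

  private
    rep : Fin m → Fin n
    rep = proj₁ components
    rep∉S : ∀ c → rep c ∉ₛ S
    rep∉S = proj₁ (proj₂ components)
    rep-separated : ∀ c c′ → Reach G S (rep c) (rep c′) → c ≡ c′
    rep-separated = proj₁ (proj₂ (proj₂ components))
    rep-reached : ∀ v → v ∉ₛ S → ∃ λ c → Reach G S v (rep c)
    rep-reached = proj₂ (proj₂ (proj₂ components))

  -- The vertices of S are sent to the junk component c₀.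
  comp : Fin n → Fin m
  comp v with v ∈? S
  ... | yes _ = c₀
  ... | no v∉S = proj₁ (rep-reached v v∉S)

  Reach-rep-comp : ∀ {v} → v ∉ₛ S → Reach G S v (rep (comp v))
  Reach-rep-comp {v} v∉S with v ∈? S
  ... | yes v∈S = contradiction v∈S v∉S
  ... | no v∉S = proj₂ (rep-reached v v∉S)

  comp-rep : ∀ c → comp (rep c) ≡ c
  comp-rep c = sym (rep-separated c (comp (rep c)) (Reach-rep-comp (rep∉S c)))

  Reach⇒comp≡ : ∀ {u v} → Reach G S u v → comp u ≡ comp v
  Reach⇒comp≡ uv = rep-separated _ _
    (Reach-trans G (Reach-sym G (Reach-rep-comp (Reach-source G uv)))
                   (Reach-trans G uv (Reach-rep-comp (Reach-target G uv))))

  Adj⇒comp≡ : ∀ {u v} → u ∉ₛ S → v ∉ₛ S → Adj G u v → comp u ≡ comp v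
  Adj⇒comp≡ u∉S v∉S uv = Reach⇒comp≡ (step u∉S uv (here v∉S))

  -- A walk between two components that avoids S - s must enter S at s, coming from the first component.
  neighbour-in-every-component : ∀ {k} → KConnected G k → ∣ S ∣ ≡ k → 1 < m → ∀ {s} → s ∈ₛ S →
                                 ∀ c → ∃ λ y → y ∉ₛ S × Adj G s y × comp y ≡ c
  neighbour-in-every-component {k} (_ , connected) ∣S∣≡k 1<m {s} s∈S c with c′ , c≢c′ ← ∃≢ 1<m c =
    follow (connected (S - s) S-s<k (rep c) (rep c′) (avoids (rep∉S c)) (avoids (rep∉S c′))) (here (rep∉S c)) refl
    where
    S-s<k : ∣ S - s ∣ < k
    S-s<k = subst (∣ S - s ∣ <_) ∣S∣≡k (x∈p⇒∣p-x∣<∣p∣ s∈S)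
    avoids : ∀ {v} → v ∉ₛ S → v ∉ₛ S - s
    avoids v∉S v∈S-s = v∉S (p─q⊆p S _ v∈S-s)
    follow : ∀ {u v} → Reach G (S - s) u v → Reach G S (rep c) u → v ≡ rep c′ →
             ∃ λ y → y ∉ₛ S × Adj G s y × comp y ≡ c
    follow (here _) reached refl = contradiction (rep-separated c c′ reached) c≢c′
    follow (step {v = w} _ uw rest) reached v≡ with w ∈? S
    ... | no w∉S = follow rest (Reach-trans G reached (step (Reach-target G reached) uw (here w∉S))) v≡
    ... | yes w∈S with w Finₚ.≟ s
    ...   | no w≢s = contradiction (x∈p∧x∉q⇒x∈p─q w∈S (x≢y⇒x∉⁅y⁆ w≢s)) (Reach-source G rest)
    ...   | yes refl = _ , Reach-target G reached , Adj-sym G uw , trans (sym (Reach⇒comp≡ reached)) (comp-rep c)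

  record InternallyMatched (M : Matching G) (c : Fin m) : Set where
    field
      unmatched-to-S : ∀ {t a} → Matched G M t a → t ∈ₛ S → a ∉ₛ S → comp a ≢ c
      covers : ∀ {v} → v ∉ₛ S → comp v ≡ c → Covered G M v

  ExposedApart : Matching G → Set
  ExposedApart M = ∀ {u v} → u ∉ₛ S → v ∉ₛ S → Exposed G M u → Exposed G M v → comp u ≡ comp v → u ≡ v

  ExposedApart⇒maximal : ∀ {M} → ExposedApart M → (∀ {v} → v ∈ₛ S → ¬ Exposed G M v) → IsMaximal G M
  ExposedApart⇒maximal apart S-covered u v uv u-exposed v-exposed =
    Adj-irrefl G uv (apart u∉S v∉S u-exposed v-exposed (Adj⇒comp≡ u∉S v∉S uv))
    where
    u∉S : u ∉ₛ S
    u∉S u∈S = S-covered u∈S u-exposed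
    v∉S : v ∉ₛ S
    v∉S v∈S = S-covered v∈S v-exposed

  private
    cross : ∀ u v → Dec (u ∈ₛ S) → Dec (v ∈ₛ S) → List (Fin m) → List (Fin m)
    cross u v (yes _) _ cs = comp v ∷ cs
    cross u v (no _) (yes _) cs = comp u ∷ cs
    cross u v (no _) (no _) cs = cs

  -- The components joined to S by edges of the list; an edge inside S contributes a junk entry.
  crossings : List (Edge G) → List (Fin m)
  crossings [] = []
  crossings ((u , v) ∷ es) = cross u v (u ∈? S) (v ∈? S) (crossings es)

  private
    cross-there : ∀ {u v c cs} (du : Dec (u ∈ₛ S)) (dv : Dec (v ∈ₛ S)) → c ∈ cs → c ∈ cross u v du dv cs
    cross-there (yes _) _ c∈ = there c∈
    cross-there (no _) (yes _) c∈ = there c∈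
    cross-there (no _) (no _) c∈ = c∈

    cross-here : ∀ {t a cs} → t ∈ₛ S → a ∉ₛ S → (dt : Dec (t ∈ₛ S)) (da : Dec (a ∈ₛ S)) → comp a ∈ cross t a dt da cs
    cross-here _ _ (yes _) _ = here refl
    cross-here t∈S _ (no t∉S) _ = contradiction t∈S t∉S

    cross-here′ : ∀ {t a cs} → t ∈ₛ S → a ∉ₛ S → (da : Dec (a ∈ₛ S)) (dt : Dec (t ∈ₛ S)) → comp a ∈ cross a t da dt cs
    cross-here′ _ a∉S (yes a∈S) _ = contradiction a∈S a∉S
    cross-here′ _ _ (no _) (yes _) = here refl
    cross-here′ t∈S _ (no _) (no t∉S) = contradiction t∈S t∉S

    inS : List (Fin n) → List (Fin n)
    inS = filter (_∈? S)

    length-inS-∷ : ∀ x xs → length (inS xs) ≤ length (inS (x ∷ xs))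
    length-inS-∷ x xs with x ∈? S
    ... | yes _ = n≤1+n _
    ... | no _ = ≤-reflexive refl

    length-cross : ∀ {u v cs} xs (du : Dec (u ∈ₛ S)) (dv : Dec (v ∈ₛ S)) →
                   length cs ≤ length (inS xs) → length (cross u v du dv cs) ≤ length (inS (u ∷ v ∷ xs))
    length-cross {u} {v} xs (yes u∈S) _ cs≤ =
      ≤-trans (s≤s (≤-trans cs≤ (length-inS-∷ v xs))) (≤-reflexive (cong length (sym (filter-accept (_∈? S) u∈S))))
    length-cross {u} {v} xs (no _) (yes v∈S) cs≤ =
      ≤-trans (s≤s cs≤)
        (≤-trans (≤-reflexive (cong length (sym (filter-accept (_∈? S) v∈S)))) (length-inS-∷ u (v ∷ xs)))
    length-cross {u} {v} xs (no _) (no _) cs≤ =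
      ≤-trans cs≤ (≤-trans (length-inS-∷ v xs) (length-inS-∷ u (v ∷ xs)))

    length-crossings : ∀ es → length (crossings es) ≤ length (inS (endpoints G es))
    length-crossings [] = z≤n
    length-crossings ((u , v) ∷ es) = length-cross (endpoints G es) (u ∈? S) (v ∈? S) (length-crossings es)

    ∈-crossings : ∀ es {t a} → (t , a) ∈ es → t ∈ₛ S → a ∉ₛ S → comp a ∈ crossings es
    ∈-crossings ((t , a) ∷ es) (here refl) t∈S a∉S = cross-here t∈S a∉S (t ∈? S) (a ∈? S)
    ∈-crossings ((u , v) ∷ es) (there ta) t∈S a∉S = cross-there (u ∈? S) (v ∈? S) (∈-crossings es ta t∈S a∉S)

    ∈-crossings′ : ∀ es {t a} → (a , t) ∈ es → t ∈ₛ S → a ∉ₛ S → comp a ∈ crossings es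
    ∈-crossings′ ((a , t) ∷ es) (here refl) t∈S a∉S = cross-here′ t∈S a∉S (a ∈? S) (t ∈? S)
    ∈-crossings′ ((u , v) ∷ es) (there at) t∈S a∉S = cross-there (u ∈? S) (v ∈? S) (∈-crossings′ es at t∈S a∉S)

  crossings-complete : ∀ M {t a} → Matched G M t a → t ∈ₛ S → a ∉ₛ S → comp a ∈ crossings (edges M)
  crossings-complete M (as-listed ta) = ∈-crossings (edges M) ta
  crossings-complete M (reversed at) = ∈-crossings′ (edges M) at

  -- Distinct crossing edges leave S at distinct vertices, none of them exposed.
  crossings-bound : ∀ M {as} → Unique as → All (_∈ₛ S) as → All (Exposed G M) as →
                    length as + length (crossings (edges M)) ≤ ∣ S ∣
  crossings-bound M {as} unique-as as⊆S as-exposed =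
    ≤-trans (+-monoʳ-≤ (length as) (length-crossings (edges M)))
      (subst (_≤ ∣ S ∣) (length-++ as)
        (Unique⇒length≤∣p∣ S (Uniqueₚ.++⁺ unique-as (Uniqueₚ.filter⁺ (_∈? S) (disjoint M)) apart)
          (Allₚ.++⁺ as⊆S (Allₚ.all-filter (_∈? S) (endpoints G (edges M))))))
    where
    apart : ∀ {v} → ¬ (v ∈ as × v ∈ filter (_∈? S) (endpoints G (edges M)))
    apart (v∈as , v∈ends) = All.lookup as-exposed v∈as (proj₁ (∈-filter⁻ (_∈? S) v∈ends))

  InternallyMatched-if : ∀ M {c} → c ∉ crossings (edges M) → (∀ {v} → v ∉ₛ S → Exposed G M v → comp v ≢ c) →
                         InternallyMatched M c
  InternallyMatched-if M {c} c-uncrossed exposed-elsewhere = record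
    { unmatched-to-S = λ ta t∈S a∉S a∈c →
        c-uncrossed (subst (_∈ crossings (edges M)) a∈c (crossings-complete M ta t∈S a∉S))
    ; covers = covers }
    where
    covers : ∀ {v} → v ∉ₛ S → comp v ≡ c → Covered G M v
    covers {v} v∉S v∈c with v ∈ₗ? endpoints G (edges M)
    ... | yes covered = covered
    ... | no exposed = contradiction v∈c (exposed-elsewhere v∉S exposed)

  module Rerouting (neighbour : ∀ {s} → s ∈ₛ S → ∀ c → ∃ λ y → y ∉ₛ S × Adj G s y × comp y ≡ c) where

    record Rerouted (M : Matching G) (a : Fin n) (c : Fin m) : Set where
      field
        matching : Matching G
        same-size : size G matching ≡ size G M
        covers-a : Covered G matching a
        keeps-S-covered : ∀ {v} → v ∈ₛ S → Covered G M v → Covered G matching v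
        apart : ExposedApart matching
        keeps-internal : ∀ {c′} → c′ ≢ c → InternallyMatched M c′ → InternallyMatched matching c′

    -- Match a to a neighbour y in c and unmatch y's partner p; the exposure moves from a to p ∈ c.
    reroute : ∀ {M a c} → a ∈ₛ S → Exposed G M a → InternallyMatched M c → ExposedApart M → Rerouted M a c
    reroute {M} {a} {c} a∈S a-exposed internal apart
      with y , y∉S , ay , y∈c ← neighbour a∈S c
      with p , yp , M₁ , ext₁ ← unmatch G M (InternallyMatched.covers internal y∉S y∈c)
      with M₂ , ext₂ ← extend G M₁ ay (a-exposed ∘ extends-covered⁺ G ext₁) (proj₁ (extends-exposes-ends G ext₁))
      = record
      { matching = M₂
      ; same-size = trans (extends-size G ext₂) (sym (extends-size G ext₁))
      ; covers-a = proj₁ (extends-covers-ends G ext₂)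
      ; keeps-S-covered = λ v∈S covered → covered-before covered (∈S⇒≢ v∈S y∉S) (∈S⇒≢ v∈S p∉S)
      ; apart = apart′
      ; keeps-internal = keeps-internal }
      where
      open InternallyMatched internal
      ∈S⇒≢ : ∀ {u v} → u ∈ₛ S → v ∉ₛ S → u ≢ v
      ∈S⇒≢ u∈S v∉S refl = v∉S u∈S
      p∉S : p ∉ₛ S
      p∉S p∈S = unmatched-to-S (Matched-sym G (extends-matches-ends G ext₁)) p∈S y∉S y∈c
      p∈c : comp p ≡ c
      p∈c = trans (sym (Adj⇒comp≡ y∉S p∉S yp)) y∈c
      covered-before : ∀ {v} → Covered G M v → v ≢ y → v ≢ p → Covered G M₂ v
      covered-before covered v≢y v≢p with extends-covered⁻ G ext₁ covered
      ... | inj₁ v≡y = contradiction v≡y v≢y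
      ... | inj₂ (inj₁ v≡p) = contradiction v≡p v≢p
      ... | inj₂ (inj₂ covered₁) = extends-covered⁺ G ext₂ covered₁
      exposed-after : ∀ {v} → Exposed G M₂ v → v ≡ p ⊎ Exposed G M v
      exposed-after {v} exposed with v Finₚ.≟ p
      ... | yes v≡p = inj₁ v≡p
      ... | no v≢p = inj₂ λ covered →
        exposed (covered-before covered (λ { refl → exposed (proj₂ (extends-covers-ends G ext₂)) }) v≢p)
      apart′ : ExposedApart M₂
      apart′ {u} {v} u∉S v∉S u-exposed v-exposed same with exposed-after u-exposed | exposed-after v-exposed
      ... | inj₁ refl | inj₁ refl = refl
      ... | inj₁ refl | inj₂ v-exposed₀ = contradiction (covers v∉S (trans (sym same) p∈c)) v-exposed₀
      ... | inj₂ u-exposed₀ | inj₁ refl = contradiction (covers u∉S (trans same p∈c)) u-exposed₀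
      ... | inj₂ u-exposed₀ | inj₂ v-exposed₀ = apart u∉S v∉S u-exposed₀ v-exposed₀ same
      keeps-internal : ∀ {c′} → c′ ≢ c → InternallyMatched M c′ → InternallyMatched M₂ c′
      keeps-internal {c′} c′≢c internal′ = record { unmatched-to-S = unmatched ; covers = covers′ }
        where
        open InternallyMatched internal′ renaming (unmatched-to-S to unmatched′; covers to covers″)
        outside : ∀ {v} → comp v ≡ c → comp v ≢ c′
        outside v∈c v∈c′ = c′≢c (trans (sym v∈c′) v∈c)
        unmatched : ∀ {t b} → Matched G M₂ t b → t ∈ₛ S → b ∉ₛ S → comp b ≢ c′
        unmatched tb t∈S b∉S with extends-matched⁻ G ext₂ tb
        ... | inj₁ (_ , refl) = outside {y} y∈c
        ... | inj₂ (inj₁ (refl , _)) = contradiction t∈S y∉S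
        ... | inj₂ (inj₂ tb₁) = unmatched′ (extends-matched⁺ G ext₁ tb₁) t∈S b∉S
        covers′ : ∀ {v} → v ∉ₛ S → comp v ≡ c′ → Covered G M₂ v
        covers′ v∉S v∈c′ = covered-before (covers″ v∉S v∈c′)
          (λ { refl → outside {y} y∈c v∈c′ }) (λ { refl → outside {p} p∈c v∈c′ })

    -- Each exposed vertex of S consumes a fresh component outside L.
    saturate : ∀ (as : List (Fin n)) (L : List (Fin m)) (M : Matching G) → All (_∈ₛ S) as →
               (∀ {v} → v ∈ₛ S → Exposed G M v → v ∈ as) → ExposedApart M →
               (∀ {c} → c ∉ L → InternallyMatched M c) → length L + length as ≤ m →
               ∃ λ M′ → size G M′ ≡ size G M × IsMaximal G M′
    saturate [] L M [] exposed⊆[] apart _ _ =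
      M , refl , ExposedApart⇒maximal {M} apart (λ v∈S exposed → contradiction (exposed⊆[] v∈S exposed) λ ())
    saturate (a ∷ as) L M (a∈S ∷ as⊆S) exposed⊆ apart internal room with a ∈ₗ? endpoints G (edges M)
    ... | yes a-covered = saturate as L M as⊆S exposed⊆′ apart internal (≤-trans (+-monoʳ-≤ (length L) (n≤1+n _)) room)
      where
      exposed⊆′ : ∀ {v} → v ∈ₛ S → Exposed G M v → v ∈ as
      exposed⊆′ v∈S exposed with exposed⊆ v∈S exposed
      ... | here refl = contradiction a-covered exposed
      ... | there v∈as = v∈as
    ... | no a-exposed with c , c∉L ← ∃∉ L (≤-trans (s≤s (m≤m+n _ _)) (≤-trans (≤-reflexive (sym (+-suc _ _))) room)) =
      let M′ , same , maximal = saturate as (c ∷ L) (Rerouted.matching r) as⊆S exposed⊆′ (Rerouted.apart r) internal′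
                                  (≤-trans (≤-reflexive (sym (+-suc _ _))) room)
      in M′ , trans same (Rerouted.same-size r) , maximal
      where
      r : Rerouted M a c
      r = reroute a∈S a-exposed (internal c∉L) apart
      exposed⊆′ : ∀ {v} → v ∈ₛ S → Exposed G (Rerouted.matching r) v → v ∈ as
      exposed⊆′ v∈S exposed with exposed⊆ v∈S (exposed ∘ Rerouted.keeps-S-covered r v∈S)
      ... | here refl = contradiction (Rerouted.covers-a r) exposed
      ... | there v∈as = v∈as
      internal′ : ∀ {c′} → c′ ∉ c ∷ L → InternallyMatched (Rerouted.matching r) c′
      internal′ c′∉ = Rerouted.keeps-internal r (c′∉ ∘ here) (internal (c′∉ ∘ there))

module _ {k n m} (G : Graph n) (connected : KConnected G k) (equimatchable : Equimatchable G)
         (factor-critical : FactorCritical G) (S : Subset n) (∣S∣≡k : ∣ S ∣ ≡ k)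
         (components : HasComponents G S m) (k<m : k < m) where

  private
    S<m : ∣ S ∣ < m
    S<m = subst (_< m) (sym ∣S∣≡k) k<m

  open Components G S components (fromℕ< (≤-trans (s≤s z≤n) k<m))

  module OneEdgeShort {x s q : Fin n} {M₁ M₂ : Matching G} (x∈S : x ∈ₛ S) (s∈S : s ∈ₛ S) (s≢x : s ≢ x)
                      (x-exposed : Exposed G M₁ x) (others-covered : ∀ w → w ≢ x → Covered G M₁ w)
                      (sq : Adj G s q) (ext : Extends G M₂ s q M₁) (2≤k : 2 ≤ k) where

    open Rerouting (neighbour-in-every-component connected ∣S∣≡k (≤-trans 2≤k (<⇒≤ k<m)))

    x-exposed₂ : Exposed G M₂ x
    x-exposed₂ = x-exposed ∘ extends-covered⁺ G ext

    s-exposed₂ : Exposed G M₂ s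
    s-exposed₂ = proj₁ (extends-exposes-ends G ext)

    q-exposed₂ : Exposed G M₂ q
    q-exposed₂ = proj₂ (extends-exposes-ends G ext)

    x≢q : x ≢ q
    x≢q refl = x-exposed (proj₂ (extends-covers-ends G ext))

    exposed₂ : ∀ {v} → Exposed G M₂ v → v ≡ x ⊎ v ≡ s ⊎ v ≡ q
    exposed₂ {v} v-exposed with v Finₚ.≟ x
    ... | yes v≡x = inj₁ v≡x
    ... | no v≢x with extends-covered⁻ G ext (others-covered v v≢x)
    ...   | inj₁ v≡s = inj₂ (inj₁ v≡s)
    ...   | inj₂ (inj₁ v≡q) = inj₂ (inj₂ v≡q)
    ...   | inj₂ (inj₂ v-covered) = contradiction v-covered v-exposed

    exposed-outside-S⇒q : ∀ {v} → v ∉ₛ S → Exposed G M₂ v → v ≡ q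
    exposed-outside-S⇒q v∉S v-exposed with exposed₂ v-exposed
    ... | inj₁ refl = contradiction x∈S v∉S
    ... | inj₂ (inj₁ refl) = contradiction s∈S v∉S
    ... | inj₂ (inj₂ v≡q) = v≡q

    apart₂ : ExposedApart M₂
    apart₂ u∉S v∉S u-exposed v-exposed _ =
      trans (exposed-outside-S⇒q u∉S u-exposed) (sym (exposed-outside-S⇒q v∉S v-exposed))

    maximal-if-q∈S : q ∈ₛ S → ∃ λ M′ → size G M′ ≡ size G M₂ × IsMaximal G M′
    maximal-if-q∈S q∈S =
      saturate (x ∷ s ∷ q ∷ []) (crossings (edges M₂)) M₂ (x∈S ∷ s∈S ∷ q∈S ∷ []) exposed⊆ apart₂ internal room
      where
      exposed⊆ : ∀ {v} → v ∈ₛ S → Exposed G M₂ v → v ∈ x ∷ s ∷ q ∷ []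
      exposed⊆ _ v-exposed with exposed₂ v-exposed
      ... | inj₁ v≡x = here v≡x
      ... | inj₂ (inj₁ v≡s) = there (here v≡s)
      ... | inj₂ (inj₂ v≡q) = there (there (here v≡q))
      internal : ∀ {c} → c ∉ crossings (edges M₂) → InternallyMatched M₂ c
      internal c∉ = InternallyMatched-if M₂ c∉ λ v∉S v-exposed _ →
        v∉S (subst (_∈ₛ S) (sym (exposed-outside-S⇒q v∉S v-exposed)) q∈S)
      room : length (crossings (edges M₂)) + 3 ≤ m
      room = ≤-trans (≤-reflexive (+-comm _ 3))
               (≤-trans (crossings-bound M₂ ((s≢x ∘ sym ∷ x≢q ∷ []) ∷ (Adj-irrefl G sq ∷ []) ∷ [] ∷ [])
                                           (x∈S ∷ s∈S ∷ q∈S ∷ []) (x-exposed₂ ∷ s-exposed₂ ∷ q-exposed₂ ∷ []))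
                        (<⇒≤ S<m))

    maximal-if-q∉S : q ∉ₛ S → ∃ λ M′ → size G M′ ≡ size G M₂ × IsMaximal G M′
    maximal-if-q∉S q∉S =
      saturate (x ∷ s ∷ []) (comp q ∷ crossings (edges M₂)) M₂ (x∈S ∷ s∈S ∷ []) exposed⊆ apart₂ internal room
      where
      exposed⊆ : ∀ {v} → v ∈ₛ S → Exposed G M₂ v → v ∈ x ∷ s ∷ []
      exposed⊆ v∈S v-exposed with exposed₂ v-exposed
      ... | inj₁ v≡x = here v≡x
      ... | inj₂ (inj₁ v≡s) = there (here v≡s)
      ... | inj₂ (inj₂ refl) = contradiction v∈S q∉S
      internal : ∀ {c} → c ∉ comp q ∷ crossings (edges M₂) → InternallyMatched M₂ c
      internal c∉ = InternallyMatched-if M₂ (c∉ ∘ there) λ v∉S v-exposed v∈c →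
        c∉ (here (trans (sym v∈c) (cong comp (exposed-outside-S⇒q v∉S v-exposed))))
      room : suc (length (crossings (edges M₂))) + 2 ≤ m
      room = ≤-trans (≤-reflexive (cong suc (+-comm _ 2)))
               (≤-trans (s≤s (crossings-bound M₂ ((s≢x ∘ sym ∷ []) ∷ [] ∷ []) (x∈S ∷ s∈S ∷ [])
                                                 (x-exposed₂ ∷ s-exposed₂ ∷ [])))
                        S<m)

    maximal-of-size-M₂ : ∃ λ M′ → size G M′ ≡ size G M₂ × IsMaximal G M′
    maximal-of-size-M₂ with q ∈? S
    ... | yes q∈S = maximal-if-q∈S q∈S
    ... | no q∉S = maximal-if-q∉S q∉S

  more-components-than-connectivity-impossible : 2 ≤ k → ⊥
  more-components-than-connectivity-impossible 2≤k
    with x , x∈S ← nonempty {p = S} (subst (0 <_) (sym ∣S∣≡k) (≤-trans (s≤s z≤n) 2≤k))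
    with s , s∈S , s≢x ← ∃∈-≢ (subst (1 <_) (sym ∣S∣≡k) 2≤k) x
    with M₁ , x-exposed , others-covered ← factor-critical x
    with q , sq , M₂ , ext ← unmatch G M₁ (others-covered s s≢x)
    with M′ , same-size , maximal ← OneEdgeShort.maximal-of-size-M₂ x∈S s∈S s≢x x-exposed others-covered sq ext 2≤k
    = equimatchable M′ maximal M₁ (≤-reflexive (trans (cong suc same-size) (sym (extends-size G ext))))

components≤connectivity : ∀ k → 2 ≤ k → ∀ {n} (G : Graph n) → KConnected G k → Equimatchable G → FactorCritical G →
                          ∀ (S : Subset n) → ∣ S ∣ ≡ k → ∀ m → HasComponents G S m → m ≤ k
components≤connectivity k 2≤k G connected equimatchable factor-critical S ∣S∣≡k m components with m ≤? k
... | yes m≤k = m≤k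
... | no m≰k = ⊥-elim (more-components-than-connectivity-impossible
                        G connected equimatchable factor-critical S ∣S∣≡k components (≰⇒> m≰k) 2≤k)

leftBlock : ∀ k m → Subset (k + m)
leftBlock zero m = ∅
leftBlock (suc k) m = inside Vec.∷ leftBlock k m

∣leftBlock∣ : ∀ k m → ∣ leftBlock k m ∣ ≡ k
∣leftBlock∣ zero m = ∣⊥∣≡0 m
∣leftBlock∣ (suc k) m = cong suc (∣leftBlock∣ k m)

↑ˡ∈leftBlock : ∀ {k} m (i : Fin k) → i ↑ˡ m ∈ₛ leftBlock k m
↑ˡ∈leftBlock m zero = Vec.here
↑ˡ∈leftBlock m (suc i) = Vec.there (↑ˡ∈leftBlock m i)

↑ʳ∉leftBlock : ∀ k {m} (j : Fin m) → k ↑ʳ j ∉ₛ leftBlock k m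
↑ʳ∉leftBlock zero j = ∉⊥
↑ʳ∉leftBlock (suc k) j (Vec.there j∈) = ↑ʳ∉leftBlock k j j∈

-- For K = k + 2: K_{K,K+1} with parts S = {s i} and T = {t j}, plus the edge t 0 — t 1. Removing S leaves the
-- K components {t 0, t 1}, {t 2}, …, {t K}; the component of t j is pinch zero j.
module Example (k : ℕ) where

  K : ℕ
  K = suc (suc k)

  N : ℕ
  N = K + suc K

  part : Fin N → Fin K ⊎ Fin (suc K)
  part = splitAt K

  s : Fin K → Fin N
  s i = i ↑ˡ suc K

  t : Fin (suc K) → Fin N
  t j = K ↑ʳ j

  part-s : ∀ i → part (s i) ≡ inj₁ i
  part-s i = Finₚ.splitAt-↑ˡ K i (suc K)

  part-t : ∀ j → part (t j) ≡ inj₂ j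
  part-t j = Finₚ.splitAt-↑ʳ K (suc K) j

  s-injective : ∀ {i i′} → s i ≡ s i′ → i ≡ i′
  s-injective = Finₚ.↑ˡ-injective (suc K) _ _

  t-injective : ∀ {j j′} → t j ≡ t j′ → j ≡ j′
  t-injective = Finₚ.↑ʳ-injective K _ _

  s≢t : ∀ i j → s i ≢ t j
  s≢t i j eq with trans (sym (part-s i)) (trans (cong part eq) (part-t j))
  ... | ()

  data Side : Fin N → Set where
    in-S : ∀ i → Side (s i)
    in-T : ∀ j → Side (t j)

  side : ∀ v → Side v
  side v with part v in eq
  ... | inj₁ i = subst Side (Finₚ.splitAt⁻¹-↑ˡ eq) (in-S i)
  ... | inj₂ j = subst Side (Finₚ.splitAt⁻¹-↑ʳ eq) (in-T j)

  t₀t₁ : Fin (suc K) → Fin (suc K) → Bool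
  t₀t₁ zero (suc zero) = true
  t₀t₁ (suc zero) zero = true
  t₀t₁ _ _ = false

  adjacency : Fin K ⊎ Fin (suc K) → Fin K ⊎ Fin (suc K) → Bool
  adjacency (inj₁ _) (inj₁ _) = false
  adjacency (inj₁ _) (inj₂ _) = true
  adjacency (inj₂ _) (inj₁ _) = true
  adjacency (inj₂ a) (inj₂ b) = t₀t₁ a b

  t₀t₁-sym : ∀ a b → t₀t₁ a b ≡ t₀t₁ b a
  t₀t₁-sym zero zero = refl
  t₀t₁-sym zero (suc zero) = refl
  t₀t₁-sym zero (suc (suc _)) = refl
  t₀t₁-sym (suc zero) zero = refl
  t₀t₁-sym (suc (suc _)) zero = refl
  t₀t₁-sym (suc zero) (suc zero) = refl
  t₀t₁-sym (suc zero) (suc (suc _)) = refl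
  t₀t₁-sym (suc (suc _)) (suc zero) = refl
  t₀t₁-sym (suc (suc _)) (suc (suc _)) = refl

  adjacency-sym : ∀ x y → adjacency x y ≡ adjacency y x
  adjacency-sym (inj₁ _) (inj₁ _) = refl
  adjacency-sym (inj₁ _) (inj₂ _) = refl
  adjacency-sym (inj₂ _) (inj₁ _) = refl
  adjacency-sym (inj₂ a) (inj₂ b) = t₀t₁-sym a b

  adjacency-irrefl : ∀ x → adjacency x x ≡ false
  adjacency-irrefl (inj₁ _) = refl
  adjacency-irrefl (inj₂ zero) = refl
  adjacency-irrefl (inj₂ (suc zero)) = refl
  adjacency-irrefl (inj₂ (suc (suc _))) = refl

  G : Graph N
  G = record
    { E = λ u v → adjacency (part u) (part v)
    ; sym = λ u v → adjacency-sym (part u) (part v)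
    ; irref = λ v → adjacency-irrefl (part v) }

  s-t-adjacent : ∀ i j → Adj G (s i) (t j)
  s-t-adjacent i j rewrite part-s i | part-t j = refl

  t-s-adjacent : ∀ j i → Adj G (t j) (s i)
  t-s-adjacent j i = Adj-sym G {s i} {t j} (s-t-adjacent i j)

  t₀-t₁-adjacent : Adj G (t zero) (t (suc zero))
  t₀-t₁-adjacent rewrite part-t zero | part-t (suc zero) = refl

  s-s-nonadjacent : ∀ i i′ → ¬ Adj G (s i) (s i′)
  s-s-nonadjacent i i′ rewrite part-s i | part-s i′ = λ ()

  t-t-adjacent⇒pinch≡ : ∀ {a b} → Adj G (t a) (t b) → pinch zero a ≡ pinch zero b
  t-t-adjacent⇒pinch≡ {a} {b} ab rewrite part-t a | part-t b = go a b ab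
    where
    go : ∀ a b → t₀t₁ a b ≡ true → pinch zero a ≡ pinch zero b
    go zero zero ()
    go zero (suc zero) _ = refl
    go zero (suc (suc _)) ()
    go (suc zero) zero _ = refl
    go (suc (suc _)) zero ()
    go (suc zero) (suc zero) ()
    go (suc zero) (suc (suc _)) ()
    go (suc (suc _)) (suc _) ()

  S : Subset N
  S = leftBlock K (suc K)

  s∈S : ∀ i → s i ∈ₛ S
  s∈S = ↑ˡ∈leftBlock (suc K)

  t∉S : ∀ j → t j ∉ₛ S
  t∉S = ↑ʳ∉leftBlock K

  k-connected : KConnected G K
  k-connected = m≤n+m (suc K) K , connected
    where
    connected : ∀ X → ∣ X ∣ < K → ConnectedMinus G X
    connected X X<K u v u∉X v∉X with side u | side v
    ... | in-S i | in-S i′ = let j , tj∉X = ∃∉ₛ t t-injective X (≤-trans X<K (n≤1+n K))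
                             in step u∉X (s-t-adjacent i j) (step tj∉X (t-s-adjacent j i′) (here v∉X))
    ... | in-S i | in-T j = step u∉X (s-t-adjacent i j) (here v∉X)
    ... | in-T j | in-S i = step u∉X (t-s-adjacent j i) (here v∉X)
    ... | in-T j | in-T j′ = let i , si∉X = ∃∉ₛ s s-injective X X<K
                             in step u∉X (t-s-adjacent j i) (step si∉X (s-t-adjacent i j′) (here v∉X))

  perfect-without-t : ∀ b → Σ (Matching G) λ M → Exposed G M (t b) × (∀ w → w ≢ t b → Covered G M w)
  perfect-without-t b with M , covered⁻ , covered⁺ ←
      pairing G s (t ∘ punchIn b) s-injective (Finₚ.punchIn-injective b _ _ ∘ t-injective)
              (λ i j → s≢t i (punchIn b j)) (λ i → s-t-adjacent i (punchIn b i)) (allFin K) (Uniqueₚ.allFin⁺ K)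
    = M , tb-exposed , others-covered
    where
    tb-exposed : Exposed G M (t b)
    tb-exposed covered with covered⁻ covered
    ... | i , _ , inj₁ tb≡si = s≢t i b (sym tb≡si)
    ... | i , _ , inj₂ tb≡t = Finₚ.punchInᵢ≢i b i (sym (t-injective tb≡t))
    others-covered : ∀ w → w ≢ t b → Covered G M w
    others-covered w w≢tb with side w
    ... | in-S i = proj₁ (covered⁺ (∈-allFin i))
    ... | in-T c with b Finₚ.≟ c
    ...   | yes refl = contradiction refl w≢tb
    ...   | no b≢c = subst (Covered G M ∘ t) (Finₚ.punchIn-punchOut b≢c) (proj₂ (covered⁺ (∈-allFin (punchOut b≢c))))

  perfect-without-s : ∀ i → Σ (Matching G) λ M → Exposed G M (s i) × (∀ w → w ≢ s i → Covered G M w)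
  perfect-without-s i = add-t₀t₁ (pairing G (s ∘ punchIn i) (λ a → t (suc (suc a)))
      (Finₚ.punchIn-injective i _ _ ∘ s-injective)
      (Finₚ.suc-injective ∘ Finₚ.suc-injective ∘ t-injective) (λ a b → s≢t (punchIn i a) (suc (suc b)))
      (λ a → s-t-adjacent (punchIn i a) (suc (suc a))) (allFin (suc k)) (Uniqueₚ.allFin⁺ (suc k)))
    where
    add-t₀t₁ : (Σ (Matching G) λ M →
                 (∀ {w} → Covered G M w → ∃ λ a → a ∈ allFin (suc k) × (w ≡ s (punchIn i a) ⊎ w ≡ t (suc (suc a)))) ×
                 (∀ {a} → a ∈ allFin (suc k) → Covered G M (s (punchIn i a)) × Covered G M (t (suc (suc a))))) →
               Σ (Matching G) λ M → Exposed G M (s i) × (∀ w → w ≢ s i → Covered G M w)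
    add-t₀t₁ (M , covered⁻ , covered⁺) = M′ , si-exposed , others-covered
      where
      t-exposed : ∀ c → (∀ a → c ≢ suc (suc a)) → Exposed G M (t c)
      t-exposed c low covered with covered⁻ covered
      ... | a , _ , inj₁ tc≡s = s≢t (punchIn i a) c (sym tc≡s)
      ... | a , _ , inj₂ tc≡t = low a (t-injective tc≡t)
      extended = extend G M t₀-t₁-adjacent (t-exposed zero λ _ ()) (t-exposed (suc zero) λ _ ())
      M′ : Matching G
      M′ = proj₁ extended
      ext : Extends G M (t zero) (t (suc zero)) M′
      ext = proj₂ extended
      si-exposed : Exposed G M′ (s i)
      si-exposed covered with extends-covered⁻ G ext covered
      ... | inj₁ si≡t₀ = s≢t i zero si≡t₀
      ... | inj₂ (inj₁ si≡t₁) = s≢t i (suc zero) si≡t₁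
      ... | inj₂ (inj₂ covered′) with covered⁻ covered′
      ...   | a , _ , inj₁ si≡s = Finₚ.punchInᵢ≢i i a (sym (s-injective si≡s))
      ...   | a , _ , inj₂ si≡t = s≢t i _ si≡t
      others-covered : ∀ w → w ≢ s i → Covered G M′ w
      others-covered w w≢si with side w
      ... | in-T zero = proj₁ (extends-covers-ends G ext)
      ... | in-T (suc zero) = proj₂ (extends-covers-ends G ext)
      ... | in-T (suc (suc a)) = extends-covered⁺ G ext (proj₂ (covered⁺ (∈-allFin a)))
      ... | in-S i′ with i Finₚ.≟ i′
      ...   | yes refl = contradiction refl w≢si
      ...   | no i≢i′ = extends-covered⁺ G ext
                          (subst (Covered G M ∘ s) (Finₚ.punchIn-punchOut i≢i′)
                                 (proj₁ (covered⁺ (∈-allFin (punchOut i≢i′)))))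

  factor-critical : FactorCritical G
  factor-critical v with side v
  ... | in-S i = perfect-without-s i
  ... | in-T j = perfect-without-t j

  size≤K : ∀ M → size G M ≤ K
  size≤K M with size G M ≤? K
  ... | yes ≤K = ≤K
  ... | no ≰K = contradiction (≤-trans (+-mono-≤ (≰⇒> ≰K) (≰⇒> ≰K)) (size+size≤n G M)) (<-irrefl refl)

  K≤maximal : ∀ M → IsMaximal G M → K ≤ size G M
  K≤maximal M maximal with Finₚ.any? (λ i → ¬? (s i ∈ₗ? endpoints G (edges M)))
  ... | yes (i , si-exposed) =
    subst (_≤ size G M) (length-map-allFin K t′)
      (independent-covered≤size G M (Uniqueₚ.map⁺ (Finₚ.suc-injective ∘ t-injective) (Uniqueₚ.allFin⁺ K))
        independent (All.tabulate covered))
    where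
    t′ : Fin K → Fin N
    t′ j = t (suc j)
    covered : ∀ {w} → w ∈ map t′ (allFin K) → Covered G M w
    covered w∈ with ∈-map⁻ t′ w∈
    ... | j , _ , refl with t′ j ∈ₗ? endpoints G (edges M)
    ...   | yes t′j-covered = t′j-covered
    ...   | no t′j-exposed = contradiction t′j-exposed (maximal (s i) (t′ j) (s-t-adjacent i (suc j)) si-exposed)
    independent : Independent G (map t′ (allFin K))
    independent uv u∈ v∈ with ∈-map⁻ t′ u∈ | ∈-map⁻ t′ v∈
    ... | a , _ , refl | b , _ , refl = Adj-irrefl G uv (cong t′ (t-t-adjacent⇒pinch≡ uv))
  ... | no none =
    subst (_≤ size G M) (length-map-allFin K s)
      (independent-covered≤size G M (Uniqueₚ.map⁺ s-injective (Uniqueₚ.allFin⁺ K)) independent (All.tabulate covered))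
    where
    covered : ∀ {w} → w ∈ map s (allFin K) → Covered G M w
    covered w∈ with ∈-map⁻ s w∈
    ... | i , _ , refl with s i ∈ₗ? endpoints G (edges M)
    ...   | yes si-covered = si-covered
    ...   | no si-exposed = contradiction (i , si-exposed) none
    independent : Independent G (map s (allFin K))
    independent uv u∈ v∈ with ∈-map⁻ s u∈ | ∈-map⁻ s v∈
    ... | a , _ , refl | b , _ , refl = s-s-nonadjacent a b uv

  equimatchable : Equimatchable G
  equimatchable M maximal M′ M<M′ = <-irrefl refl (<-≤-trans (≤-<-trans (K≤maximal M maximal) M<M′) (size≤K M′))

  Reach-within-T : ∀ {u v} → Reach G S u v → ∀ a → u ≡ t a → ∃ λ b → v ≡ t b × pinch zero a ≡ pinch zero b
  Reach-within-T (here _) a refl = a , refl , refl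
  Reach-within-T (step {v = w} _ uw rest) a refl with side w
  ... | in-S i = contradiction (s∈S i) (Reach-source G rest)
  ... | in-T b with b′ , v≡ , pinch≡ ← Reach-within-T rest b refl = b′ , v≡ , trans (t-t-adjacent⇒pinch≡ uw) pinch≡

  rep : Fin K → Fin N
  rep c = t (suc c)

  separated : ∀ c c′ → Reach G S (rep c) (rep c′) → c ≡ c′
  separated c c′ reach with b , eq , pinch≡ ← Reach-within-T reach (suc c) refl =
    trans pinch≡ (cong (pinch zero) (sym (t-injective eq)))

  reached : ∀ v → v ∉ₛ S → ∃ λ c → Reach G S v (rep c)
  reached v v∉S with side v
  ... | in-S i = contradiction (s∈S i) v∉S
  ... | in-T zero = zero , step v∉S t₀-t₁-adjacent (here (t∉S (suc zero)))
  ... | in-T (suc c) = c , here v∉S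

  components : HasComponents G S K
  components = rep , (λ c → t∉S (suc c)) , separated , reached

  cut : IsVertexCut G S
  cut = rep zero , rep (suc zero) , t∉S (suc zero) , t∉S (suc (suc zero)) , (λ ()) ∘ separated zero (suc zero)

tight-example : ∀ k → 2 ≤ k → Σ ℕ λ n → Σ (Graph n) λ G → KConnected G k × Equimatchable G × FactorCritical G ×
                (Σ (Subset n) λ S → IsVertexCut G S × ∣ S ∣ ≡ k × HasComponents G S k)
tight-example (suc (suc k)) (s≤s (s≤s z≤n)) =
  N , G , k-connected , equimatchable , factor-critical , S , cut , ∣leftBlock∣ K (suc K) , components
  where open Example k

proposition12 :
    (∀ (k : ℕ) → 3 ≤ k → ∀ (n : ℕ) (G : Graph n) →
       KConnected G k → Equimatchable G → FactorCritical G →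
       ∀ (S : Subset n) → IsVertexCut G S → ∣ S ∣ ≡ k →
       ∀ (m : ℕ) → HasComponents G S m → m ≤ k)
    ×
    (∀ (k : ℕ) → 3 ≤ k → Σ ℕ λ n → Σ (Graph n) λ G →
       KConnected G k × Equimatchable G × FactorCritical G ×
       (Σ (Subset n) λ S → IsVertexCut G S × ∣ S ∣ ≡ k × HasComponents G S k))
proposition12 =
  (λ k 3≤k n G connected equimatchable factor-critical S _ ∣S∣≡k →
     components≤connectivity k (≤-trans (n≤1+n 2) 3≤k) G connected equimatchable factor-critical S ∣S∣≡k) ,
  (λ k 3≤k → tight-example k (≤-trans (n≤1+n 2) 3≤k))
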